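{- Let $P,K:\mathbb{N}_0\to\mathbb{N}_0$ be any scaling. Then $\lim_{n\to\infty}q(\theta_n)=1$ if and only if $\lim_{n\to\infty}\frac{K_n^2}{P_n}=0$, and under either condition $$1-q(\theta_n)\sim\frac{K_n^2}{P_n}\quad(n\to\infty).$$
   Context: A scaling is a pair of maps $P,K:\mathbb{N}_0\to\mathbb{N}_0$ with $K_n\le P_n$ for all $n$; write $\theta_n=(K_n,P_n)$. For positive integers $K\le P$ and $\theta=(K,P)$, define $q(\theta)=0$ if $P<2K$ and $q(\theta)=\binom{P-K}{K}\big/\binom{P}{K}$ if $2K\le P$ (the probability that two independent uniformly random $K$-subsets of $\{1,\dots,P\}$ are disjoint). The notation $a_n\sim b_n$ means $a_n/b_n\to1$. -}

module Defs where

open import Data.Nat as ℕ using (ℕ; zero; suc; _∸_; _<?_)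
open import Data.Nat.Combinatorics using (_C_)
open import Data.Integer using (+_)
open import Data.Rational using (ℚ; _/_; _÷_; _-_; ∣_∣; _<_; _≟_; 0ℚ; 1ℚ; ≢-nonZero)
open import Data.Product using (∃-syntax; _×_)
open import Relation.Nullary using (yes; no)

-- the ratio a / d of natural numbers as a rational; convention: 0 when d = 0
-- (only ever used with d ≠ 0 under the hypotheses of the statement)
frac : ℕ → ℕ → ℚ
frac a zero    = 0ℚ
frac a (suc d) = (+ a) / suc d

-- division of rationals; convention: 0 when the divisor is 0
_÷'_ : ℚ → ℚ → ℚ
p ÷' r with r ≟ 0ℚ
... | yes _  = 0ℚ
... | no r≢0 = _÷_ p r {{≢-nonZero r≢0}}

-- q(θ) for θ = (K , P): 0 if P < 2K, else C(P-K,K) / C(P,K)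
q : ℕ → ℕ → ℚ
q K P with P <? 2 ℕ.* K
... | yes _ = 0ℚ
... | no _  = frac ((P ∸ K) C K) (P C K)

Tendsto : (ℕ → ℚ) → ℚ → Set
Tendsto a L = ∀ (ε : ℚ) → 0ℚ < ε → ∃[ N ] (∀ n → N ℕ.≤ n → ∣ a n - L ∣ < ε)

_∼_ : (ℕ → ℚ) → (ℕ → ℚ) → Set
a ∼ b = Tendsto (λ n → a n ÷' b n) 1ℚ

module Submission where

-- Let q = q(K, P) be the probability that two independent uniform K-subsets of
-- a P-set are disjoint.  For P = D + K ≥ 2K we have q = A / B with
-- A = C(D,K), B = C(P,K), and E = B − A counts the K-subsets meeting a fixed one.
-- The heart of the proof is the two-sided estimate
--
--     K² / (P + K²)  ≤  1 − q  =  E / B  ≤  K² / D ,                         (★)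
--
-- obtained from falling factorials, C(n,k) · k! = n (n−1) ⋯ (n−k+1), by an
-- induction over the K draws ('FallingFactorial', 'Binomial').

module FallingFactorial where

  open import Data.Nat
  open import Data.Nat.Properties
  open import Data.Nat.Combinatorics.Base using (_P′_)
  open import Data.Nat.Tactic.RingSolver using (solve-∀)
  open import Algebra.Properties.CommutativeSemigroup *-commutativeSemigroup
    using (xy∙z≈y∙xz; x∙yz≈y∙xz)
  open import Relation.Binary.PropositionalEquality
  open import Relation.Nullary using (yes; no)

  -- The inductive step of 'falling-upper', written with D = d + j so that
  -- the new factors of D P′ (suc j) and (D + K) P′ (suc j) are d and d + K.
  upper-step : ∀ {D} d j K X Y → d + j ≡ D →
               Y * (D + K + j * K) ≤ (D + K) * X →
               d * Y * (D + K + suc j * K) ≤ (D + K) * ((d + K) * X)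
  upper-step d j K X Y refl ih = begin
    d * Y * (D + K + suc j * K)     ≡⟨ xy∙z≈y∙xz d Y _ ⟩
    Y * (d * (D + K + suc j * K))   ≤⟨ *-monoʳ-≤ Y factor ⟩
    Y * ((d + K) * (D + K + j * K)) ≡⟨ x∙yz≈y∙xz Y (d + K) _ ⟩
    (d + K) * (Y * (D + K + j * K)) ≤⟨ *-monoʳ-≤ (d + K) ih ⟩
    (d + K) * ((D + K) * X)         ≡⟨ x∙yz≈y∙xz (d + K) (D + K) X ⟩
    (D + K) * ((d + K) * X)         ∎
    where
    open ≤-Reasoning
    D : ℕ
    D = d + j
    factor-identity : ∀ d j K → d * (d + j + K + suc j * K) + K * (j + K + j * K) ≡ (d + K) * (d + j + K + j * K)
    factor-identity = solve-∀
    factor : d * (D + K + suc j * K) ≤ (d + K) * (D + K + j * K)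
    factor = subst (d * (D + K + suc j * K) ≤_) (factor-identity d j K) (m≤m+n _ _)

  -- The probability D P′ j / (D + K) P′ j that j draws without replacement
  -- from D + K points all avoid a fixed K-set is at most (D + K) / (D + K + j K).
  -- (Once j ≥ D the left-hand side vanishes.)
  falling-upper : ∀ D K j → (D P′ j) * (D + K + j * K) ≤ (D + K) * ((D + K) P′ j)
  falling-upper D K zero = ≤-reflexive (base D K)
    where
    base : ∀ D K → 1 * (D + K + 0 * K) ≡ (D + K) * 1
    base = solve-∀
  falling-upper D K (suc j) with j ≤? D
  ... | yes j≤D = subst (λ e → (D ∸ j) * (D P′ j) * (D + K + suc j * K) ≤ (D + K) * (e * ((D + K) P′ j)))
                   (sym (+-∸-comm K j≤D))
                   (upper-step (D ∸ j) j K ((D + K) P′ j) (D P′ j) (m∸n+n≡m j≤D) (falling-upper D K j))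
  ... | no  j≰D rewrite m≤n⇒m∸n≡0 (<⇒≤ (≰⇒> j≰D)) = z≤n

  lower-step : ∀ {D} d j K X Y → d + j ≡ D → j ≤ K →
               X * D ≤ Y * D + j * K * X →
               (d + K) * X * D ≤ d * Y * D + suc j * K * ((d + K) * X)
  lower-step d j K X Y refl j≤K ih = begin
    (d + K) * X * (d + j)                                   ≡⟨ expand d j K X ⟩
    d * (X * (d + j)) + K * X * d + K * X * j               ≤⟨ +-mono-≤ (+-monoˡ-≤ (K * X * d) (*-monoʳ-≤ d ih))
                                                                         (*-monoʳ-≤ (K * X) j≤K) ⟩
    d * (Y * (d + j) + j * K * X) + K * X * d + K * X * K   ≤⟨ m≤m+n _ (j * K * K * X) ⟩
    d * (Y * (d + j) + j * K * X) + K * X * d + K * X * K + j * K * K * X ≡⟨ collect d j K X Y ⟩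
    d * Y * (d + j) + suc j * K * ((d + K) * X)             ∎
    where
    open ≤-Reasoning
    expand : ∀ d j K X → (d + K) * X * (d + j) ≡ d * (X * (d + j)) + K * X * d + K * X * j
    expand = solve-∀
    collect : ∀ d j K X Y → d * (Y * (d + j) + j * K * X) + K * X * d + K * X * K + j * K * K * X
                          ≡ d * Y * (d + j) + suc j * K * ((d + K) * X)
    collect = solve-∀

  -- 1 − D P′ j / (D + K) P′ j  ≤  j K / D  for j ≤ K and j ≤ D: a union bound
  -- over the j draws, each hitting the fixed K-set with probability ≤ K / D.
  falling-lower : ∀ D K j → j ≤ K → j ≤ D →
                  ((D + K) P′ j) * D ≤ (D P′ j) * D + j * K * ((D + K) P′ j)
  falling-lower D K zero    _    _    = m≤m+n _ 0
  falling-lower D K (suc j) sj≤K sj≤D =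
    subst (λ e → e * ((D + K) P′ j) * D ≤ (D ∸ j) * (D P′ j) * D + suc j * K * (e * ((D + K) P′ j)))
      (sym (+-∸-comm K j≤D))
      (lower-step (D ∸ j) j K ((D + K) P′ j) (D P′ j) (m∸n+n≡m j≤D) (<⇒≤ sj≤K)
        (falling-lower D K j (<⇒≤ sj≤K) j≤D))
    where
    j≤D : j ≤ D
    j≤D = <⇒≤ sj≤D

  falling-mono : ∀ {m n} k → m ≤ n → m P′ k ≤ n P′ k
  falling-mono zero    m≤n = ≤-refl
  falling-mono (suc k) m≤n = *-mono-≤ (∸-monoˡ-≤ k m≤n) (falling-mono k m≤n)

  falling-pos : ∀ {n} k → k ≤ n → 0 < n P′ k
  falling-pos zero    _    = z<s
  falling-pos (suc k) k<n = *-mono-< (m<n⇒0<n∸m k<n) (falling-pos k (<⇒≤ k<n))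


module Binomial where

  open import Data.Nat
  open import Data.Nat.Properties
  open import Data.Nat.Combinatorics using (_C_; nCk≡nPk/k!)
  open import Data.Nat.Combinatorics.Base using (_P_; _P′_)
  open import Data.Nat.Combinatorics.Specification using (k!∣nP′k; nPk≡n!/[n∸k]!; nP′k≡n!/[n∸k]!)
  open import Data.Nat.DivMod using (_/_; m/n*n≡m)
  open import Algebra.Properties.CommutativeSemigroup *-commutativeSemigroup using (xy∙z≈xz∙y)
  open import Relation.Binary.PropositionalEquality
  open import Data.Nat.Tactic.RingSolver using (solve-∀)
  open FallingFactorial

  C*!≡P′ : ∀ {n k} → k ≤ n → (n C k) * k ! ≡ n P′ k
  C*!≡P′ {n} {k} k≤n = begin
    (n C k) * k !        ≡⟨ cong (_* k !) (nCk≡nPk/k! k≤n) ⟩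
    ((n P k) / k !) * k !  ≡⟨ cong (λ p → (p / k !) * k !) P≡P′ ⟩
    ((n P′ k) / k !) * k ! ≡⟨ m/n*n≡m (k!∣nP′k k≤n) ⟩
    n P′ k               ∎
    where
    open ≡-Reasoning
    instance _ = k !≢0
    P≡P′ : n P k ≡ n P′ k
    P≡P′ = trans (nPk≡n!/[n∸k]! k≤n) (sym (nP′k≡n!/[n∸k]! k≤n))

  binomial-pos : ∀ {n k} → k ≤ n → 0 < n C k
  binomial-pos {n} {k} k≤n = n≢0⇒n>0 λ C≡0 →
    <⇒≢ (falling-pos k k≤n) (sym (trans (sym (C*!≡P′ k≤n)) (cong (_* k !) C≡0)))

  binomial-mono : ∀ {m n k} → k ≤ m → m ≤ n → m C k ≤ n C k
  binomial-mono {m} {n} {k} k≤m m≤n = *-cancelʳ-≤ (m C k) (n C k) (k !) {{k !≢0}}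
    (subst₂ _≤_ (sym (C*!≡P′ k≤m)) (sym (C*!≡P′ (≤-trans k≤m m≤n))) (falling-mono k m≤n))

  -- 'falling-upper' for j = K, divided by K !:
  --   C(D,K) / C(D+K,K)  ≤  (D + K) / (D + K + K²).
  binomial-upper : ∀ {D K} → K ≤ D → (D C K) * (D + K + K * K) ≤ (D + K) * ((D + K) C K)
  binomial-upper {D} {K} K≤D = *-cancelʳ-≤ _ _ (K !) {{K !≢0}} (begin
    (D C K) * T * K !               ≡⟨ xy∙z≈xz∙y (D C K) T (K !) ⟩
    (D C K) * K ! * T               ≡⟨ cong (_* T) (C*!≡P′ K≤D) ⟩
    (D P′ K) * T                    ≤⟨ falling-upper D K K ⟩
    (D + K) * ((D + K) P′ K)        ≡⟨ cong ((D + K) *_) (C*!≡P′ (m≤n+m K D)) ⟨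
    (D + K) * (((D + K) C K) * K !) ≡⟨ *-assoc (D + K) _ _ ⟨
    (D + K) * ((D + K) C K) * K !   ∎)
    where
    open ≤-Reasoning
    T : ℕ
    T = D + K + K * K

  -- 'falling-lower' for j = K, divided by K !:
  --   1 − C(D,K) / C(D+K,K)  ≤  K² / D.
  binomial-lower : ∀ {D K} → K ≤ D → ((D + K) C K) * D ≤ (D C K) * D + K * K * ((D + K) C K)
  binomial-lower {D} {K} K≤D = *-cancelʳ-≤ _ _ (K !) {{K !≢0}} (begin
    B * D * K !                                ≡⟨ xy∙z≈xz∙y B D (K !) ⟩
    B * K ! * D                                ≡⟨ cong (_* D) B*! ⟩
    ((D + K) P′ K) * D                         ≤⟨ falling-lower D K K ≤-refl K≤D ⟩
    (D P′ K) * D + K * K * ((D + K) P′ K)      ≡⟨ cong₂ (λ u v → u * D + K * K * v) A*! B*! ⟨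
    A * K ! * D + K * K * (B * K !)            ≡⟨ regroup A B D (K * K) (K !) ⟩
    (A * D + K * K * B) * K !                  ∎)
    where
    open ≤-Reasoning
    A : ℕ
    A = D C K
    B : ℕ
    B = (D + K) C K
    A*! : (D C K) * K ! ≡ D P′ K
    A*! = C*!≡P′ K≤D
    B*! : ((D + K) C K) * K ! ≡ (D + K) P′ K
    B*! = C*!≡P′ (m≤n+m K D)
    regroup : ∀ A B D S f → A * f * D + S * (B * f) ≡ (A * D + S * B) * f
    regroup = solve-∀

  -- The number of K-subsets of a (D + K)-set meeting a fixed K-subset;
  -- the remaining D C K subsets avoid it.
  meeting : ℕ → ℕ → ℕ
  meeting D K = (D + K) C K ∸ D C K

  meeting-split : ∀ {D K} → K ≤ D → D C K + meeting D K ≡ (D + K) C K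
  meeting-split {D} K≤D = m+[n∸m]≡n (binomial-mono K≤D (m≤m+n D _))

  meeting-upper : ∀ {D K} → K ≤ D → meeting D K * D ≤ K * K * ((D + K) C K)
  meeting-upper {D} {K} K≤D = +-cancelˡ-≤ (A * D) _ _ (begin
    A * D + E * D  ≡⟨ *-distribʳ-+ D A E ⟨
    (A + E) * D    ≡⟨ cong (_* D) (meeting-split K≤D) ⟩
    B * D          ≤⟨ binomial-lower K≤D ⟩
    A * D + K * K * B ∎)
    where
    open ≤-Reasoning
    A : ℕ
    A = D C K
    B : ℕ
    B = (D + K) C K
    E : ℕ
    E = meeting D K

  meeting-lower : ∀ {D K} → K ≤ D → ((D + K) C K) * (K * K) ≤ meeting D K * (D + K + K * K)
  meeting-lower {D} {K} K≤D = begin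
    B * S          ≡⟨ cong (_* S) (meeting-split K≤D) ⟨
    (A + E) * S    ≡⟨ *-distribʳ-+ S A E ⟩
    A * S + E * S  ≤⟨ +-monoˡ-≤ (E * S) A*S≤N*E ⟩
    N * E + E * S  ≡⟨ cong (_+ E * S) (*-comm N E) ⟩
    E * N + E * S  ≡⟨ *-distribˡ-+ E N S ⟨
    E * (N + S)    ∎
    where
    open ≤-Reasoning
    N : ℕ
    N = D + K
    S : ℕ
    S = K * K
    A : ℕ
    A = D C K
    B : ℕ
    B = N C K
    E : ℕ
    E = meeting D K
    A*S≤N*E : A * S ≤ N * E
    A*S≤N*E = +-cancelˡ-≤ (A * N) _ _ (begin
      A * N + A * S  ≡⟨ *-distribˡ-+ A N S ⟨
      A * (N + S)    ≤⟨ binomial-upper K≤D ⟩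
      N * B          ≡⟨ cong (N *_) (meeting-split K≤D) ⟨
      N * (A + E)    ≡⟨ *-distribˡ-+ N A E ⟩
      N * A + N * E  ≡⟨ cong (_+ N * E) (*-comm N A) ⟩
      A * N + N * E  ∎)


module Estimates where

  open import Data.Nat
  open import Data.Nat.Properties
  open import Data.Nat.Tactic.RingSolver using (solve-∀)
  open import Algebra.Properties.CommutativeSemigroup *-commutativeSemigroup using (x∙yz≈y∙xz; xy∙z≈xz∙y)
  open import Data.Sum using (inj₁; inj₂)
  open import Relation.Binary.PropositionalEquality

  distance-bound-≤ : ∀ {x y} z M → x ≤ y → y * M < x * M + z → ∣ x - y ∣ * M < z
  distance-bound-≤ {x} {y} z M x≤y y< = begin-strict
    ∣ x - y ∣ * M      ≡⟨ cong (_* M) (m≤n⇒∣m-n∣≡n∸m x≤y) ⟩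
    (y ∸ x) * M        ≡⟨ *-distribʳ-∸ M y x ⟩
    y * M ∸ x * M      <⟨ ∸-monoˡ-< y< (*-monoˡ-≤ M x≤y) ⟩
    x * M + z ∸ x * M  ≡⟨ m+n∸m≡n (x * M) z ⟩
    z                  ∎
    where open ≤-Reasoning

  distance-bound : ∀ x y z M → x * M < y * M + z → y * M < x * M + z → ∣ x - y ∣ * M < z
  distance-bound x y z M x< y< with ≤-total x y
  ... | inj₁ x≤y = distance-bound-≤ z M x≤y y<
  ... | inj₂ y≤x = subst (λ e → e * M < z) (∣-∣-comm y x) (distance-bound-≤ z M y≤x x<)

  fraction-small : ∀ E B D K S M .{{_ : NonZero M}} → 0 < B → K ≤ S →
                   E * D ≤ S * B → S * (M + M) < D + K → E * M < B
  fraction-small E B D K S M 0<B K≤S upper small = ≰⇒> λ B≤EM → <⇒≱ small (begin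
    D + K          ≤⟨ +-mono-≤ (D≤SM B≤EM) (≤-trans K≤S (m≤m*n S M)) ⟩
    S * M + S * M  ≡⟨ *-distribˡ-+ S M M ⟨
    S * (M + M)    ∎)
    where
    open ≤-Reasoning
    D≤SM : B ≤ E * M → D ≤ S * M
    D≤SM B≤EM = *-cancelˡ-≤ E (begin
      E * D        ≤⟨ upper ⟩
      S * B        ≤⟨ *-monoʳ-≤ S B≤EM ⟩
      S * (E * M)  ≡⟨ x∙yz≈y∙xz S E M ⟩
      E * (S * M)  ∎)
      where instance _ = m*n≢0⇒m≢0 E {{>-nonZero (<-≤-trans 0<B B≤EM)}}

  ratio-small : ∀ E B N S M .{{_ : NonZero M}} → 0 < S →
                B * S ≤ E * (N + S) → E * (M + M) < B → S * M < N
  ratio-small E B N S M 0<S lower small = +-cancelʳ-< S (S * M) N (begin-strict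
    S * M + S      ≤⟨ +-monoʳ-≤ (S * M) (m≤m*n S M) ⟩
    S * M + S * M  ≡⟨ *-distribˡ-+ S M M ⟨
    S * (M + M)    <⟨ *-cancelˡ-< B _ _ B*bound ⟩
    N + S          ∎)
    where
    open ≤-Reasoning
    instance _ = >-nonZero (<-≤-trans 0<S (m≤n+m S N))
    B*bound : B * (S * (M + M)) < B * (N + S)
    B*bound = begin-strict
      B * (S * (M + M))  ≡⟨ *-assoc B S (M + M) ⟨
      B * S * (M + M)    ≤⟨ *-monoˡ-≤ (M + M) lower ⟩
      E * (N + S) * (M + M) ≡⟨ xy∙z≈xz∙y E (N + S) (M + M) ⟩
      E * (M + M) * (N + S) <⟨ *-monoˡ-< (N + S) small ⟩
      B * (N + S)        ∎

  -- With  S / (N + S) ≤ E / B ≤ S / D  (N = D + K, 0 < K ≤ S)  and  E / B < 1 / M,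
  -- the ratio (E / B) / (S / N) = E N / B S is within 1 / M of 1.
  ratio-error : ∀ E B D K S M .{{_ : NonZero M}} → 0 < K → K ≤ S →
                E * D ≤ S * B → B * S ≤ E * (D + K + S) → E * M < B →
                ∣ E * (D + K) - B * S ∣ * M < B * S
  ratio-error E B D K S M 0<K K≤S upper lower EM<B = distance-bound (E * (D + K)) (B * S) (B * S) M above below
    where
    open ≤-Reasoning
    N : ℕ
    N = D + K
    instance
      _ = >-nonZero 0<K
      _ = >-nonZero (<-≤-trans 0<K K≤S)
    above : E * N * M < B * S * M + B * S
    above = begin-strict
      E * N * M                 ≡⟨ split-N E D K M ⟩
      E * D * M + E * M * K     ≤⟨ +-monoˡ-≤ (E * M * K) (*-monoˡ-≤ M upper) ⟩
      S * B * M + E * M * K     <⟨ +-monoʳ-< (S * B * M) (*-monoˡ-< K EM<B) ⟩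
      S * B * M + B * K         ≤⟨ +-monoʳ-≤ (S * B * M) (*-monoʳ-≤ B K≤S) ⟩
      S * B * M + B * S         ≡⟨ cong (λ t → t * M + B * S) (*-comm S B) ⟩
      B * S * M + B * S         ∎
      where
      split-N : ∀ E D K M → E * (D + K) * M ≡ E * D * M + E * M * K
      split-N = solve-∀
    below : B * S * M < E * N * M + B * S
    below = begin-strict
      B * S * M                 ≤⟨ *-monoˡ-≤ M lower ⟩
      E * (N + S) * M           ≡⟨ split-S E N S M ⟩
      E * N * M + E * M * S     <⟨ +-monoʳ-< (E * N * M) (*-monoˡ-< S EM<B) ⟩
      E * N * M + B * S         ∎
      where
      split-S : ∀ E N S M → E * (N + S) * M ≡ E * N * M + E * M * S
      split-S = solve-∀


module Fractions where

  open import Defs using (frac; _÷'_; Tendsto)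
  open import Data.Nat as ℕ using (ℕ; zero; suc; z<s; NonZero)
  import Data.Nat.Properties as ℕP
  open import Data.Nat.Tactic.RingSolver using (solve-∀)
  open import Data.Integer as ℤ using (+_; +<+)
  import Data.Integer.Properties as ℤP
  open import Data.Integer.Tactic.RingSolver using () renaming (solve-∀ to ℤsolve-∀)
  open import Data.Rational as ℚ
    using (ℚ; mkℚ; _<_; _+_; _*_; _-_; -_; 1/_; ∣_∣; 0ℚ; 1ℚ; toℚᵘ; _≟_; ≢-nonZero)
  import Data.Rational.Properties as ℚP
  open import Data.Rational.Unnormalised as ℚᵘ using (mkℚᵘ; *<*; *≡*)
  import Data.Rational.Unnormalised.Properties as ℚᵘP
  open import Data.Product using (∃-syntax; _,_)
  open import Data.Sum using (inj₁; inj₂)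
  open import Relation.Binary.PropositionalEquality
  open import Relation.Nullary using (yes; no)
  open import Data.Empty using (⊥-elim)
  open import Algebra.Properties.Group ℚP.+-0-group using (//-rightDividesʳ; ⁻¹-anti-homo-//)

  frac≃ : ∀ a d → toℚᵘ (frac a (suc d)) ℚᵘ.≃ mkℚᵘ (+ a) d
  frac≃ a d = ℚP.toℚᵘ-fromℚᵘ (mkℚᵘ (+ a) d)

  frac-< : ∀ a b c d → 0 ℕ.< b → 0 ℕ.< d → a ℕ.* d ℕ.< c ℕ.* b → frac a b < frac c d
  frac-< a (suc b) c (suc d) _ _ lt = ℚP.toℚᵘ-cancel-<
    (ℚᵘP.<-respʳ-≃ (ℚᵘP.≃-sym (frac≃ c d)) (ℚᵘP.<-respˡ-≃ (ℚᵘP.≃-sym (frac≃ a b))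
      (*<* (subst₂ ℤ._<_ (ℤP.pos-* a (suc d)) (ℤP.pos-* c (suc b)) (+<+ lt)))))

  frac-<⁻ : ∀ a b c d → 0 ℕ.< b → 0 ℕ.< d → frac a b < frac c d → a ℕ.* d ℕ.< c ℕ.* b
  frac-<⁻ a (suc b) c (suc d) _ _ lt
    with ℚᵘP.<-respʳ-≃ (frac≃ c d) (ℚᵘP.<-respˡ-≃ (frac≃ a b) (ℚP.toℚᵘ-mono-< lt))
  ... | *<* lt′ = ℤP.drop‿+<+ (subst₂ ℤ._<_ (sym (ℤP.pos-* a (suc d))) (sym (ℤP.pos-* c (suc b))) lt′)

  frac-cong : ∀ a b c d → 0 ℕ.< b → 0 ℕ.< d → a ℕ.* d ≡ c ℕ.* b → frac a b ≡ frac c d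
  frac-cong a (suc b) c (suc d) _ _ eq = ℚP.toℚᵘ-injective (begin
    toℚᵘ (frac a (suc b)) ≈⟨ frac≃ a b ⟩
    mkℚᵘ (+ a) b          ≈⟨ *≡* (trans (sym (ℤP.pos-* a (suc d))) (trans (cong +_ eq) (ℤP.pos-* c (suc b)))) ⟩
    mkℚᵘ (+ c) d          ≈⟨ frac≃ c d ⟨
    toℚᵘ (frac c (suc d)) ∎)
    where open ℚᵘP.≃-Reasoning

  frac-+ : ∀ {a c b} → 0 ℕ.< b → frac a b + frac c b ≡ frac (a ℕ.+ c) b
  frac-+ {a} {c} {suc b} _ = ℚP.toℚᵘ-injective (begin
    toℚᵘ (frac a (suc b) + frac c (suc b))            ≈⟨ ℚP.toℚᵘ-homo-+ (frac a (suc b)) (frac c (suc b)) ⟩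
    toℚᵘ (frac a (suc b)) ℚᵘ.+ toℚᵘ (frac c (suc b))  ≈⟨ ℚᵘP.+-cong (frac≃ a b) (frac≃ c b) ⟩
    mkℚᵘ (+ a) b ℚᵘ.+ mkℚᵘ (+ c) b                    ≈⟨ *≡* cross ⟩
    mkℚᵘ (+ (a ℕ.+ c)) b                              ≈⟨ frac≃ (a ℕ.+ c) b ⟨
    toℚᵘ (frac (a ℕ.+ c) (suc b))                     ∎)
    where
    open ℚᵘP.≃-Reasoning
    s : ℤ.ℤ
    s = + suc b
    regroup : ∀ x y s → (x ℤ.* s ℤ.+ y ℤ.* s) ℤ.* s ≡ (x ℤ.+ y) ℤ.* (s ℤ.* s)
    regroup = ℤsolve-∀
    cross : (+ a ℤ.* s ℤ.+ + c ℤ.* s) ℤ.* s ≡ + (a ℕ.+ c) ℤ.* + (suc b ℕ.* suc b)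
    cross = trans (regroup (+ a) (+ c) s) (cong₂ ℤ._*_ (sym (ℤP.pos-+ a c)) (sym (ℤP.pos-* (suc b) (suc b))))

  frac-* : ∀ a b c d → 0 ℕ.< b → 0 ℕ.< d → frac a b * frac c d ≡ frac (a ℕ.* c) (b ℕ.* d)
  frac-* a (suc b) c (suc d) _ _ = ℚP.toℚᵘ-injective (begin
    toℚᵘ (frac a (suc b) * frac c (suc d))            ≈⟨ ℚP.toℚᵘ-homo-* (frac a (suc b)) (frac c (suc d)) ⟩
    toℚᵘ (frac a (suc b)) ℚᵘ.* toℚᵘ (frac c (suc d))  ≈⟨ ℚᵘP.*-cong (frac≃ a b) (frac≃ c d) ⟩
    mkℚᵘ (+ a) b ℚᵘ.* mkℚᵘ (+ c) d                    ≈⟨ *≡* (cong (ℤ._* + (suc b ℕ.* suc d)) (sym (ℤP.pos-* a c))) ⟩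
    mkℚᵘ (+ (a ℕ.* c)) (d ℕ.+ b ℕ.* suc d)            ≈⟨ frac≃ (a ℕ.* c) _ ⟨
    toℚᵘ (frac (a ℕ.* c) (suc b ℕ.* suc d))           ∎)
    where open ℚᵘP.≃-Reasoning

  frac-one : ∀ {b} → 0 ℕ.< b → frac b b ≡ 1ℚ
  frac-one {b} 0<b = frac-cong b b 1 1 0<b z<s (ℕP.*-comm b 1)

  frac-zero : ∀ {b} → 0 ℕ.< b → frac 0 b ≡ 0ℚ
  frac-zero {b} 0<b = frac-cong 0 b 0 1 0<b z<s refl

  frac-nonneg : ∀ {a b} → 0 ℕ.< b → ∣ frac a b ∣ ≡ frac a b
  frac-nonneg {a} {suc b} _ = ℚP.0≤p⇒∣p∣≡p (ℚP.nonNegative⁻¹ _ {{ℚP.normalize-nonNeg a (suc b)}})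

  frac-∸ : ∀ {a c b} → 0 ℕ.< b → c ℕ.≤ a → frac a b - frac c b ≡ frac (a ℕ.∸ c) b
  frac-∸ {a} {c} {b} 0<b c≤a = begin
    frac a b - frac c b                         ≡⟨ cong (λ x → frac x b - frac c b) (ℕP.m∸n+n≡m c≤a) ⟨
    frac (a ℕ.∸ c ℕ.+ c) b - frac c b           ≡⟨ cong (_- frac c b) (frac-+ 0<b) ⟨
    frac (a ℕ.∸ c) b + frac c b - frac c b      ≡⟨ //-rightDividesʳ (frac c b) (frac (a ℕ.∸ c) b) ⟩
    frac (a ℕ.∸ c) b                            ∎
    where open ≡-Reasoning

  frac-distance-≥ : ∀ {a c b} → 0 ℕ.< b → c ℕ.≤ a → ∣ frac a b - frac c b ∣ ≡ frac ℕ.∣ a - c ∣ b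
  frac-distance-≥ {a} {c} {b} 0<b c≤a = begin
    ∣ frac a b - frac c b ∣  ≡⟨ cong ∣_∣ (frac-∸ 0<b c≤a) ⟩
    ∣ frac (a ℕ.∸ c) b ∣     ≡⟨ frac-nonneg 0<b ⟩
    frac (a ℕ.∸ c) b         ≡⟨ cong (λ n → frac n b) (ℕP.m≤n⇒∣n-m∣≡n∸m c≤a) ⟨
    frac ℕ.∣ a - c ∣ b         ∎
    where open ≡-Reasoning

  frac-distance : ∀ {a c b} → 0 ℕ.< b → ∣ frac a b - frac c b ∣ ≡ frac ℕ.∣ a - c ∣ b
  frac-distance {a} {c} {b} 0<b with ℕP.≤-total c a
  ... | inj₁ c≤a = frac-distance-≥ 0<b c≤a
  ... | inj₂ a≤c = begin
    ∣ frac a b - frac c b ∣     ≡⟨ ℚP.∣-p∣≡∣p∣ (frac a b - frac c b) ⟨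
    ∣ - (frac a b - frac c b) ∣ ≡⟨ cong ∣_∣ (⁻¹-anti-homo-// (frac a b) (frac c b)) ⟩
    ∣ frac c b - frac a b ∣     ≡⟨ frac-distance-≥ 0<b a≤c ⟩
    frac ℕ.∣ c - a ∣ b            ≡⟨ cong (λ n → frac n b) (ℕP.∣-∣-comm c a) ⟩
    frac ℕ.∣ a - c ∣ b            ∎
    where open ≡-Reasoning

  frac-pos : ∀ a b → 0 ℕ.< a → 0 ℕ.< b → 0ℚ < frac a b
  frac-pos a b 0<a 0<b = subst (_< frac a b) (frac-zero {1} z<s)
    (frac-< 0 1 a b z<s 0<b (subst (0 ℕ.<_) (sym (ℕP.*-identityʳ a)) 0<a))

  frac-÷' : ∀ {a b c d} → 0 ℕ.< b → 0 ℕ.< c → 0 ℕ.< d → frac a b ÷' frac c d ≡ frac (a ℕ.* d) (b ℕ.* c)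
  frac-÷' {a} {suc b} {suc c} {suc d} _ _ _ with frac (suc c) (suc d) ≟ 0ℚ
  ... | yes r≡0 = ⊥-elim (ℚP.<⇒≢ (frac-pos (suc c) (suc d) z<s z<s) (sym r≡0))
  ... | no  r≢0 = begin
    p * 1/ r         ≡⟨ cong (_* 1/ r) s*r≡p ⟨
    s * r * 1/ r     ≡⟨ ℚP.*-assoc s r (1/ r) ⟩
    s * (r * 1/ r)   ≡⟨ cong (s *_) (ℚP.*-inverseʳ r) ⟩
    s * 1ℚ           ≡⟨ ℚP.*-identityʳ s ⟩
    s                ∎
    where
    open ≡-Reasoning
    instance _ = ≢-nonZero r≢0
    p : ℚ
    p = frac a (suc b)
    r : ℚ
    r = frac (suc c) (suc d)
    s : ℚ
    s = frac (a ℕ.* suc d) (suc b ℕ.* suc c)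
    cross : ∀ a b c d → a ℕ.* d ℕ.* c ℕ.* b ≡ a ℕ.* (b ℕ.* c ℕ.* d)
    cross = solve-∀
    s*r≡p : s * r ≡ p
    s*r≡p = trans (frac-* (a ℕ.* suc d) (suc b ℕ.* suc c) (suc c) (suc d) z<s z<s)
      (frac-cong (a ℕ.* suc d ℕ.* suc c) (suc b ℕ.* suc c ℕ.* suc d) a (suc b) z<s z<s
        (cross a (suc b) (suc c) (suc d)))

  close-frac : ∀ a c b M → 0 ℕ.< b → 0 ℕ.< M →
               ℕ.∣ a - c ∣ ℕ.* M ℕ.< b → ∣ frac a b - frac c b ∣ < frac 1 M
  close-frac a c b M 0<b 0<M lt = subst (_< _) (sym (frac-distance 0<b))
    (frac-< ℕ.∣ a - c ∣ b 1 M 0<b 0<M (subst (_ ℕ.<_) (sym (ℕP.*-identityˡ b)) lt))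

  close-frac⁻ : ∀ a c b M → 0 ℕ.< b → 0 ℕ.< M →
                ∣ frac a b - frac c b ∣ < frac 1 M → ℕ.∣ a - c ∣ ℕ.* M ℕ.< b
  close-frac⁻ a c b M 0<b 0<M lt = subst (_ ℕ.<_) (ℕP.*-identityˡ b)
    (frac-<⁻ ℕ.∣ a - c ∣ b 1 M 0<b 0<M (subst (_< _) (frac-distance 0<b) lt))

  archimedean : ∀ ε → 0ℚ < ε → ∃[ m ] frac 1 (suc m) < ε
  archimedean ε@(mkℚ (+ suc k) d _) _ = suc d , subst (frac 1 (suc (suc d)) <_) (ℚP.fromℚᵘ-toℚᵘ ε)
    (frac-< 1 (suc (suc d)) (suc k) (suc d) z<s z<s (subst (ℕ._< suc k ℕ.* suc (suc d)) (sym (ℕP.*-identityˡ (suc d)))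
      (ℕP.<-≤-trans (ℕP.n<1+n (suc d)) (ℕP.m≤n*m (suc (suc d)) (suc k)))))
  archimedean (mkℚ (+ zero)   _ _) (ℚ.*<* (+<+ ()))
  archimedean (mkℚ ℤ.-[1+ _ ] _ _) (ℚ.*<* ())

  near-zero : ∀ a b M → 0 ℕ.< b → 0 ℕ.< M → a ℕ.* M ℕ.< b → ∣ frac a b - 0ℚ ∣ < frac 1 M
  near-zero a b M 0<b 0<M lt = subst (λ z → ∣ frac a b - z ∣ < frac 1 M) (frac-zero 0<b)
    (close-frac a 0 b M 0<b 0<M (subst (λ x → x ℕ.* M ℕ.< b) (sym (ℕP.∣-∣-identityʳ a)) lt))

  near-zero⁻ : ∀ a b M → 0 ℕ.< b → 0 ℕ.< M → ∣ frac a b - 0ℚ ∣ < frac 1 M → a ℕ.* M ℕ.< b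
  near-zero⁻ a b M 0<b 0<M lt = subst (λ x → x ℕ.* M ℕ.< b) (ℕP.∣-∣-identityʳ a)
    (close-frac⁻ a 0 b M 0<b 0<M (subst (λ z → ∣ frac a b - z ∣ < frac 1 M) (sym (frac-zero 0<b)) lt))

  near-one : ∀ a b M → 0 ℕ.< b → 0 ℕ.< M → ℕ.∣ a - b ∣ ℕ.* M ℕ.< b → ∣ frac a b - 1ℚ ∣ < frac 1 M
  near-one a b M 0<b 0<M lt = subst (λ z → ∣ frac a b - z ∣ < frac 1 M) (frac-one 0<b)
    (close-frac a b b M 0<b 0<M lt)

  near-one⁻ : ∀ a b M → 0 ℕ.< b → 0 ℕ.< M → ∣ frac a b - 1ℚ ∣ < frac 1 M → ℕ.∣ a - b ∣ ℕ.* M ℕ.< b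
  near-one⁻ a b M 0<b 0<M lt = close-frac⁻ a b b M 0<b 0<M
    (subst (λ z → ∣ frac a b - z ∣ < frac 1 M) (sym (frac-one 0<b)) lt)

  tendsto-transfer : ∀ a L b L′ →
    (∀ n M .{{_ : NonZero M}} → ∣ a n - L ∣ < frac 1 (M ℕ.+ M) → ∣ b n - L′ ∣ < frac 1 M) →
    Tendsto a L → Tendsto b L′
  tendsto-transfer a L b L′ step lim ε 0<ε with archimedean ε 0<ε
  ... | m , 1/m<ε with lim (frac 1 (suc m ℕ.+ suc m)) (frac-pos 1 (suc m ℕ.+ suc m) z<s z<s)
  ...   | N , close = N , λ n N≤n → ℚP.<-trans (step n (suc m) (close n N≤n)) 1/m<ε


module Disjointness where

  open import Defs
  open import Data.Nat as ℕ using (ℕ; z<s; _∸_; _<?_; NonZero; >-nonZero; >-nonZero⁻¹)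
  import Data.Nat.Properties as ℕP
  open import Data.Nat.Combinatorics using (_C_)
  open import Data.Rational using (_<_; _-_; ∣_∣; 0ℚ; 1ℚ)
  open import Relation.Binary.PropositionalEquality
  open import Relation.Nullary using (yes; no)
  open import Data.Empty using (⊥-elim)
  open Binomial
  open Estimates
  open Fractions

  q-empty : ∀ {K P} → P ℕ.< 2 ℕ.* K → q K P ≡ 0ℚ
  q-empty {K} {P} P<2K with P <? 2 ℕ.* K
  ... | yes _    = refl
  ... | no  P≮2K = ⊥-elim (P≮2K P<2K)

  2*K≡K+K : ∀ K → 2 ℕ.* K ≡ K ℕ.+ K
  2*K≡K+K K = cong (K ℕ.+_) (ℕP.+-identityʳ K)

  q-split : ∀ {D K} → K ℕ.≤ D → q K (D ℕ.+ K) ≡ frac (D C K) ((D ℕ.+ K) C K)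
  q-split {D} {K} K≤D with D ℕ.+ K <? 2 ℕ.* K
  ... | yes P<2K = ⊥-elim (ℕP.<⇒≱ P<2K (ℕP.≤-trans (ℕP.≤-reflexive (2*K≡K+K K)) (ℕP.+-monoˡ-≤ K K≤D)))
  ... | no  _    = cong (λ x → frac (x C K) ((D ℕ.+ K) C K)) (ℕP.m+n∸n≡m D K)

  data Splits (K : ℕ) : ℕ → Set where
    split : ∀ D → K ℕ.≤ D → Splits K (D ℕ.+ K)

  splits : ∀ {K P} → K ℕ.+ K ℕ.≤ P → Splits K P
  splits {K} {P} 2K≤P = subst (Splits K) (ℕP.m∸n+n≡m (ℕP.≤-trans (ℕP.m≤m+n K K) 2K≤P))
    (split (P ∸ K) (subst (ℕ._≤ P ∸ K) (ℕP.m+n∸m≡n K K) (ℕP.∸-monoˡ-≤ K 2K≤P)))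

  avoiding-gap : ∀ {D K} → K ℕ.≤ D → ℕ.∣ D C K - (D ℕ.+ K) C K ∣ ≡ meeting D K
  avoiding-gap {D} {K} K≤D = subst (λ b → ℕ.∣ D C K - b ∣ ≡ meeting D K) (meeting-split K≤D)
    (ℕP.∣m-m+n∣≡n (D C K) (meeting D K))

  small-ratio⇒K+K≤P : ∀ {K P} M .{{_ : NonZero M}} → 0 ℕ.< K → K ℕ.* K ℕ.* (M ℕ.+ M) ℕ.< P → K ℕ.+ K ℕ.≤ P
  small-ratio⇒K+K≤P {K} {P} M 0<K small = ℕP.<⇒≤ (ℕP.≤-<-trans K+K≤ small)
    where
    instance _ = >-nonZero 0<K
    K≤S*M : K ℕ.≤ K ℕ.* K ℕ.* M
    K≤S*M = ℕP.≤-trans (ℕP.m≤m*n K K) (ℕP.m≤m*n (K ℕ.* K) M)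
    K+K≤ : K ℕ.+ K ℕ.≤ K ℕ.* K ℕ.* (M ℕ.+ M)
    K+K≤ = ℕP.≤-trans (ℕP.+-mono-≤ K≤S*M K≤S*M) (ℕP.≤-reflexive (sym (ℕP.*-distribˡ-+ (K ℕ.* K) M M)))

  K≤K*K : ∀ {K} → 0 ℕ.< K → K ℕ.≤ K ℕ.* K
  K≤K*K {K} 0<K = ℕP.m≤m*n K K {{>-nonZero 0<K}}

  K*K-pos : ∀ {K} → 0 ℕ.< K → 0 ℕ.< K ℕ.* K
  K*K-pos 0<K = ℕP.*-mono-< 0<K 0<K

  q-near-one : ∀ {K P} M .{{_ : NonZero M}} → 0 ℕ.< K →
               K ℕ.* K ℕ.* (M ℕ.+ M) ℕ.< P → ∣ q K P - 1ℚ ∣ < frac 1 M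
  q-near-one {K} M 0<K small with splits {K} (small-ratio⇒K+K≤P M 0<K small)
  ... | split D K≤D = subst (λ x → ∣ x - 1ℚ ∣ < frac 1 M) (sym (q-split {D} {K} K≤D))
    (near-one (D C K) B M 0<B (>-nonZero⁻¹ M) (subst (λ x → x ℕ.* M ℕ.< B) (sym (avoiding-gap K≤D)) E*M<B))
    where
    B : ℕ
    B = (D ℕ.+ K) C K
    0<B : 0 ℕ.< B
    0<B = binomial-pos (ℕP.m≤n+m K D)
    E*M<B : meeting D K ℕ.* M ℕ.< B
    E*M<B = fraction-small (meeting D K) B D K (K ℕ.* K) M 0<B (K≤K*K 0<K) (meeting-upper K≤D) small

  -- ∣ q − 1 ∣ < 1 / 2M  ⇒  K² / P < 1 / M.  (For P < 2K, q = 0 is never that close to 1.)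
  ratio-near-zero : ∀ {K P} M .{{_ : NonZero M}} → 0 ℕ.< K → K ℕ.≤ P →
                    ∣ q K P - 1ℚ ∣ < frac 1 (M ℕ.+ M) → ∣ frac (K ℕ.* K) P - 0ℚ ∣ < frac 1 M
  ratio-near-zero {K} {P} M 0<K K≤P near with K ℕ.+ K ℕ.≤? P
  ... | no  P≱2K = ⊥-elim (ℕP.<⇒≱ (near-one⁻ 0 1 (M ℕ.+ M) z<s 0<2M
          (subst (λ x → ∣ x - 1ℚ ∣ < frac 1 (M ℕ.+ M)) (q-empty {K} P<2K) near))
          (subst (1 ℕ.≤_) (sym (ℕP.*-identityˡ (M ℕ.+ M))) 0<2M))
    where
    P<2K : P ℕ.< 2 ℕ.* K
    P<2K = subst (P ℕ.<_) (sym (2*K≡K+K K)) (ℕP.≰⇒> P≱2K)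
    1≤M : 1 ℕ.≤ M
    1≤M = >-nonZero⁻¹ M
    0<2M : 0 ℕ.< M ℕ.+ M
    0<2M = ℕP.<-≤-trans 1≤M (ℕP.m≤m+n M M)
  ... | yes 2K≤P with splits {K} 2K≤P
  ...   | split D K≤D = near-zero S N M (ℕP.<-≤-trans 0<K K≤P) (>-nonZero⁻¹ M)
          (ratio-small E B N S M (K*K-pos 0<K) (meeting-lower K≤D) E*2M<B)
    where
    N : ℕ
    N = D ℕ.+ K
    S : ℕ
    S = K ℕ.* K
    B : ℕ
    B = N C K
    E : ℕ
    E = meeting D K
    0<B : 0 ℕ.< B
    0<B = binomial-pos (ℕP.m≤n+m K D)
    0<2M : 0 ℕ.< M ℕ.+ M
    0<2M = ℕP.<-≤-trans (>-nonZero⁻¹ M) (ℕP.m≤m+n M M)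
    E*2M<B : E ℕ.* (M ℕ.+ M) ℕ.< B
    E*2M<B = subst (λ x → x ℕ.* (M ℕ.+ M) ℕ.< B) (avoiding-gap K≤D)
      (near-one⁻ (D C K) B (M ℕ.+ M) 0<B 0<2M
        (subst (λ x → ∣ x - 1ℚ ∣ < frac 1 (M ℕ.+ M)) (q-split {D} {K} K≤D) near))

  relative-error-small : ∀ {K P} M .{{_ : NonZero M}} → 0 ℕ.< K → K ℕ.* K ℕ.* (M ℕ.+ M) ℕ.< P →
                         ∣ (1ℚ - q K P) ÷' frac (K ℕ.* K) P - 1ℚ ∣ < frac 1 M
  relative-error-small {K} M 0<K small with splits {K} (small-ratio⇒K+K≤P M 0<K small)
  ... | split D K≤D = subst (λ x → ∣ x - 1ℚ ∣ < frac 1 M) (sym ratio≡)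
    (near-one (E ℕ.* P) (B ℕ.* S) M (ℕP.*-mono-< 0<B 0<S) (>-nonZero⁻¹ M)
      (ratio-error E B D K S M 0<K (K≤K*K 0<K) (meeting-upper K≤D) (meeting-lower K≤D)
        (fraction-small E B D K S M 0<B (K≤K*K 0<K) (meeting-upper K≤D) small)))
    where
    open ≡-Reasoning
    P : ℕ
    P = D ℕ.+ K
    S : ℕ
    S = K ℕ.* K
    B : ℕ
    B = P C K
    E : ℕ
    E = meeting D K
    0<B : 0 ℕ.< B
    0<B = binomial-pos (ℕP.m≤n+m K D)
    0<S : 0 ℕ.< S
    0<S = K*K-pos 0<K
    ratio≡ : (1ℚ - q K P) ÷' frac S P ≡ frac (E ℕ.* P) (B ℕ.* S)
    ratio≡ = begin
      (1ℚ - q K P) ÷' frac S P                  ≡⟨ cong (λ x → (x - q K P) ÷' frac S P) (frac-one 0<B) ⟨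
      (frac B B - q K P) ÷' frac S P            ≡⟨ cong (λ x → (frac B B - x) ÷' frac S P) (q-split {D} {K} K≤D) ⟩
      (frac B B - frac (D C K) B) ÷' frac S P   ≡⟨ cong (_÷' frac S P) (frac-∸ 0<B (binomial-mono K≤D (ℕP.m≤m+n D K))) ⟩
      frac E B ÷' frac S P                      ≡⟨ frac-÷' 0<B 0<S (ℕP.<-≤-trans 0<K (ℕP.m≤n+m K D)) ⟩
      frac (E ℕ.* P) (B ℕ.* S)                  ∎

  ratio-bound : ∀ {K P} M .{{_ : NonZero M}} → 0 ℕ.< K → K ℕ.≤ P →
                ∣ frac (K ℕ.* K) P - 0ℚ ∣ < frac 1 (M ℕ.+ M) → K ℕ.* K ℕ.* (M ℕ.+ M) ℕ.< P
  ratio-bound {K} {P} M 0<K K≤P = near-zero⁻ (K ℕ.* K) P (M ℕ.+ M) (ℕP.<-≤-trans 0<K K≤P)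
    (ℕP.<-≤-trans (>-nonZero⁻¹ M) (ℕP.m≤m+n M M))


open import Defs
open import Data.Nat using (ℕ; _≤_; _*_)
open import Data.Rational using (ℚ; 0ℚ; 1ℚ; _-_)
open import Data.Product using (_×_; _,_)
open import Function.Bundles using (_⇔_; mk⇔)
open Fractions using (tendsto-transfer)
open Disjointness using (ratio-near-zero; ratio-bound; q-near-one; relative-error-small)

lemma5 : (K P : ℕ → ℕ) → (∀ n → 1 ≤ K n) → (∀ n → K n ≤ P n) →
    (Tendsto (λ n → q (K n) (P n)) 1ℚ ⇔ Tendsto (λ n → frac (K n * K n) (P n)) 0ℚ)
    × (Tendsto (λ n → frac (K n * K n) (P n)) 0ℚ →
       (λ n → 1ℚ - q (K n) (P n)) ∼ (λ n → frac (K n * K n) (P n)))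
lemma5 K P 0<K K≤P = mk⇔ q→1⇒ratio→0 ratio→0⇒q→1 , ratio→0⇒asymptotic
  where
  qs ratios : ℕ → ℚ
  qs n = q (K n) (P n)
  ratios n = frac (K n * K n) (P n)

  q→1⇒ratio→0 : Tendsto qs 1ℚ → Tendsto ratios 0ℚ
  q→1⇒ratio→0 = tendsto-transfer qs 1ℚ ratios 0ℚ λ n M →
    ratio-near-zero M (0<K n) (K≤P n)

  ratio→0⇒q→1 : Tendsto ratios 0ℚ → Tendsto qs 1ℚ
  ratio→0⇒q→1 = tendsto-transfer ratios 0ℚ qs 1ℚ λ n M near →
    q-near-one M (0<K n) (ratio-bound M (0<K n) (K≤P n) near)

  ratio→0⇒asymptotic : Tendsto ratios 0ℚ → (λ n → 1ℚ - qs n) ∼ ratios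
  ratio→0⇒asymptotic = tendsto-transfer ratios 0ℚ (λ n → (1ℚ - qs n) ÷' ratios n) 1ℚ λ n M near →
    relative-error-small M (0<K n) (ratio-bound M (0<K n) (K≤P n) near)
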